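{- Let $\mathit{Acc}$ be a batch-mode hardware accelerator and $\mathit{Spec}:(A\times D)\times S_R\to O$ an abstract specification function. If $\mathit{Acc}$ is single-action correct with respect to $\mathit{Spec}$ and is not functionally correct with respect to $\mathit{Spec}$ (i.e., has a bug), then $\mathit{Acc}$ is not strongly functionally consistent.
   Context: A batch-mode hardware accelerator (HA) is a tuple $\mathit{Acc}=(b,A,D,O,S,s_{c,I},s_{c,F},S_{m,I},T)$ where: $b\ge 1$ is an integer (batch size); $A$, $D$, $O$ are finite sets (actions, data, outputs); $S=S_C\times S_M$ with $S_C$ the control states and $S_M=S_{In}\times S_{Out}\times S_R\times S_N$ the memory states, where $S_{In}=(A\times D)^b$, $S_{Out}=O^b$, $S_R$ (relevant states), $S_N$ (non-relevant states); $s_{c,I}\in S_C$ is the initial control state, with initial states $S_I=\{s_{c,I}\}\times S_M$; $s_{c,F}\in S_C$ the final control state, with final states $S_F=\{s_{c,F}\}\times S_M$; $S_{m,I}\subseteq S_M$ gives the concrete initial states $S_{CI}=\{s_{c,I}\}\times S_{m,I}$; $T:S\to S$ is the transition function. For $s=(s_c,(s_{in},s_{out},s_r,s_n))$: $\mathit{ctrl}(s)=s_c$, $\mathit{mem}(s)$ its memory state, $\mathit{inp}(s)=s_{in}$, $\mathit{out}(s)=s_{out}$, $\mathit{rel}(s)=s_r$. Input batches are $in\in(A\times D)^b$ with components $in(j)$; similarly $o(j)$ for $o\in O^b$. For $s_0\in S_I$, $\mathbf{T}(s_0)=\langle s_1,\dots,s_k\rangle$ with $s_i=T(s_{i-1})$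 and $k$ least with $s_k\in S_F$ (assumed to exist, with $\mathit{ctrl}(s_i)\neq s_{c,I}$ for $i>0$). For $\mathbf{in}=\langle in_1,\dots,in_n\rangle$ and $s_0\in S_I$, $\mathit{StateSeq}(\mathbf{in},s_0)$: let $s_0'$ be $s_0$ with $\mathit{inp}(s_0)$ replaced by $in_1$ and $\mathbf{s}'=s_0'\cdot\mathbf{T}(s_0')$; if $n=1$ the result is $\mathbf{s}'$; else with $s_f$ the unique final state of $\mathbf{s}'$ and $s_i=(s_{c,I},\mathit{mem}(s_f))$, the result is $\mathbf{s}'\cdot\mathit{StateSeq}(\langle in_2,\dots,in_n\rangle,s_i)$. $\mathit{initsym}(\mathbf{s})$, $\mathit{final}(\mathbf{s})$ are the subsequences of initial, resp. final, states. A state $s$ is reachable if $s\in S_{CI}$ or $s\in\mathit{StateSeq}(\mathbf{in},s_0)$ for some $s_0\in S_{CI}$ and sequence $\mathbf{in}$; a relevant state $r$ is reachable if $r=\mathit{rel}(s)$ for some reachable $s$. $\mathit{Spec}:(A\times D)\times S_R\to O$. Functional correctness w.r.t. $\mathit{Spec}$: for all $s_0\in S_{CI}$ and all $\mathbf{in}=\langle in_1,\dots,in_n\rangle$, with $\mathbf{s}=\mathit{StateSeq}(\mathbf{in},s_0)$, $\mathit{initsym}(\mathbf{s})=\langle s_{I,1},\dots,s_{I,n}\rangle$, $\mathit{out}(\mathit{final}(\mathbf{s}))=\langle o_1,\dots,o_n\rangle$: $o_n(j)=\mathit{Spec}(in_n(j),\mathit{rel}(s_{I,n}))$ for all $j\in[1,b]$.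 Strong functional consistency: for all reachable initial states $s_0,s_0'\in S_I$ and input batches $in,in'$, letting $o$, $o'$ be the outputs ($\mathit{out}$) of the final states of $\mathit{StateSeq}(\langle in\rangle,s_0)$, $\mathit{StateSeq}(\langle in'\rangle,s_0')$ respectively, for all $j,j'\in[1,b]$: $in(j)=in'(j')\wedge\mathit{rel}(s_0)=\mathit{rel}(s_0')\Rightarrow o(j)=o'(j')$. Single-action correctness w.r.t. $\mathit{Spec}$: for every $(a,d)\in A\times D$ and every reachable relevant state $r$ there is a reachable initial state $s\in S_I$ and an index $j$ with $\mathit{inp}(s)(j)=(a,d)$, $\mathit{rel}(s)=r$, and $\mathit{out}(\mathit{final}(\mathbf{T}(s)))(j)=\mathit{Spec}((a,d),r)$. -}

module Defs where

open import Data.Nat using (ℕ; zero; suc; _≤_; _<_)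
open import Data.Fin using (Fin)
open import Data.Product using (Σ; ∃; _×_; _,_; proj₁; proj₂)
open import Data.Sum using (_⊎_)
open import Data.List using (List; []; _∷_)
open import Data.List.NonEmpty using (List⁺; _∷_; _∷⁺_; last)
open import Function.Bundles using (_↔_)
open import Relation.Binary.PropositionalEquality using (_≡_; _≢_)

iterateN : {X : Set} → (X → X) → ℕ → X → X
iterateN f zero    x = x
iterateN f (suc n) x = f (iterateN f n x)

-- Memory states S_M = S_In × S_Out × S_R × S_N with S_In = (A × D)^b, S_Out = O^b
-- (tuples of length b are represented as functions Fin b → _).
record HA : Set₁ where
  field
    b     : ℕ
    b≥1   : 1 ≤ b
    A D O : Set
    A-finite : ∃ λ n → Fin n ↔ A
    D-finite : ∃ λ n → Fin n ↔ D
    O-finite : ∃ λ n → Fin n ↔ O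
    SC SR SN : Set          -- control, relevant, non-relevant states
    s-cI  : SC
    s-cF  : SC

  Batch : Set
  Batch = Fin b → (A × D)

  Outs : Set
  Outs = Fin b → O

  SM : Set
  SM = Batch × Outs × SR × SN

  S : Set
  S = SC × SM

  ctrl : S → SC
  ctrl = proj₁

  mem : S → SM
  mem = proj₂

  field
    SmI : SM → Set
    T   : S → S

  iter : ℕ → S → S
  iter = iterateN T

  field
    terminates : ∀ (m : SM) → ∃ λ k → 1 ≤ k × ctrl (iter k (s-cI , m)) ≡ s-cF
    noReturn   : ∀ (m : SM) (i : ℕ) → 1 ≤ i →
                 (∀ j → 1 ≤ j → j < i → ctrl (iter j (s-cI , m)) ≢ s-cF) →
                 ctrl (iter i (s-cI , m)) ≢ s-cI

module _ (H : HA) where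
  open HA H

  inp : S → Batch
  inp (_ , (i , _ , _ , _)) = i

  out : S → Outs
  out (_ , (_ , o , _ , _)) = o

  rel : S → SR
  rel (_ , (_ , _ , r , _)) = r

  load : Batch → S → S
  load in' (c , (_ , o , r , n)) = (c , (in' , o , r , n))

  Initial : S → Set
  Initial s = ctrl s ≡ s-cI

  ConcreteInitial : S → Set
  ConcreteInitial s = ctrl s ≡ s-cI × SmI (mem s)

  -- k is the least k ≥ 1 with T^k(s) ∈ S_F, i.e. 𝐓(s) = ⟨T¹ s, …, T^k s⟩
  FirstFinal : S → ℕ → Set
  FirstFinal s k = 1 ≤ k × ctrl (iter k s) ≡ s-cF
                 × (∀ j → 1 ≤ j → j < k → ctrl (iter j s) ≢ s-cF)

  FinalOfT : S → S → Set
  FinalOfT s sf = ∃ λ k → FirstFinal s k × iter k s ≡ sf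

  -- Exec s₀ ins segs : running StateSeq(ins, s₀); segs lists, for each input batch,
  -- the pair (initial state s_{I,i} of that segment, final state of that segment);
  -- i.e. segs zips initsym(StateSeq(ins,s₀)) with final(StateSeq(ins,s₀)).
  data Exec : S → List⁺ Batch → List⁺ (S × S) → Set where
    exec-one  : ∀ {s₀ i sf} → FinalOfT (load i s₀) sf →
                Exec s₀ (i ∷ []) ((load i s₀ , sf) ∷ [])
    exec-cons : ∀ {s₀ i i₂ is sf segs} → FinalOfT (load i s₀) sf →
                Exec (s-cI , mem sf) (i₂ ∷ is) segs →
                Exec s₀ (i ∷ i₂ ∷ is) ((load i s₀ , sf) ∷⁺ segs)

  -- InSeq s₀ ins s : s occurs in StateSeq(ins, s₀)
  data InSeq : S → List Batch → S → Set where
    inseq-seg   : ∀ {s₀ i is k j} → FirstFinal (load i s₀) k → j ≤ k →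
                  InSeq s₀ (i ∷ is) (iter j (load i s₀))
    inseq-later : ∀ {s₀ i is k s} → FirstFinal (load i s₀) k →
                  InSeq (s-cI , mem (iter k (load i s₀))) is s →
                  InSeq s₀ (i ∷ is) s

  Reachable : S → Set
  Reachable s = ConcreteInitial s
              ⊎ (∃ λ s₀ → ∃ λ ins → ConcreteInitial s₀ × InSeq s₀ ins s)

  ReachableRel : SR → Set
  ReachableRel r = ∃ λ s → Reachable s × rel s ≡ r

  FunctionallyCorrect : ((A × D) × SR → O) → Set
  FunctionallyCorrect Spec =
    ∀ s₀ → ConcreteInitial s₀ → ∀ ins segs → Exec s₀ ins segs →
    ∀ (j : Fin b) →
      out (proj₂ (last segs)) j ≡ Spec (last ins j , rel (proj₁ (last segs)))

  StronglyFunctionallyConsistent : Set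
  StronglyFunctionallyConsistent =
    ∀ s₀ s₀′ → Initial s₀ → Initial s₀′ → Reachable s₀ → Reachable s₀′ →
    ∀ (i i′ : Batch) sf sf′ →
      FinalOfT (load i s₀) sf → FinalOfT (load i′ s₀′) sf′ →
    ∀ (j j′ : Fin b) → i j ≡ i′ j′ → rel s₀ ≡ rel s₀′ → out sf j ≡ out sf′ j′

  SingleActionCorrect : ((A × D) × SR → O) → Set
  SingleActionCorrect Spec =
    ∀ (a : A) (d : D) (r : SR) → ReachableRel r →
      ∃ λ s → Initial s × Reachable s ×
        ∃ λ (j : Fin b) → inp s j ≡ (a , d) × rel s ≡ r ×
          ∃ λ sf → FinalOfT s sf × out sf j ≡ Spec ((a , d) , r)

{-# OPTIONS --safe #-}
-- The contrapositive: single-action correctness plus strong consistency imply functional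
-- correctness. For every reachable initial state s and lane j, single-action correctness
-- provides some reachable run on the same action and relevant state whose output meets Spec,
-- and strong consistency transfers that output to lane j of the run from s. The last segment
-- of any execution from a concrete initial state starts in such a reachable initial state.
module Submission where

open import Defs
open import Data.Nat using (z≤n)
open import Data.Product using (_×_; _,_; proj₁; proj₂)
open import Data.Sum using (inj₂)
open import Data.List as List using ([]; _∷_)
open import Data.List.NonEmpty using (List⁺; _∷_; _∷⁺_; last; toList)
open import Relation.Nullary using (¬_)
open import Function using (_∘_)
open import Relation.Binary.PropositionalEquality using (_≡_; refl; sym; trans; cong; subst; module ≡-Reasoning)
open ≡-Reasoning

last-∷⁺ : ∀ {X : Set} (x : X) (xs : List⁺ X) → last (x ∷⁺ xs) ≡ last xs
last-∷⁺ x (y ∷ ys) with List.initLast ys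
... | []           = refl
... | _ List.∷ʳ′ _ = refl

module _ (H : HA) where
  open HA H

  initial-last-segment : ∀ {s₀ ins segs} → Exec H s₀ ins segs → Initial H s₀ →
                         Initial H (proj₁ (last segs))
  initial-last-segment (exec-one _)     init = init
  initial-last-segment (exec-cons {segs = segs} _ e) _ =
    subst (Initial H ∘ proj₁) (sym (last-∷⁺ _ segs)) (initial-last-segment e refl)

  inp-last-segment : ∀ {s₀ ins segs} → Exec H s₀ ins segs →
                     inp H (proj₁ (last segs)) ≡ last ins
  inp-last-segment (exec-one _) = refl
  inp-last-segment (exec-cons {i = i} {i₂ = i₂} {is = is} {segs = segs} _ e) = begin
    inp H (proj₁ (last (_ ∷⁺ segs))) ≡⟨ cong (inp H ∘ proj₁) (last-∷⁺ _ segs) ⟩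
    inp H (proj₁ (last segs))        ≡⟨ inp-last-segment e ⟩
    last (i₂ ∷ is)                   ≡⟨ sym (last-∷⁺ i (i₂ ∷ is)) ⟩
    last (i ∷ i₂ ∷ is)               ∎

  final-last-segment : ∀ {s₀ ins segs} → Exec H s₀ ins segs →
                       FinalOfT H (proj₁ (last segs)) (proj₂ (last segs))
  final-last-segment (exec-one fin) = fin
  final-last-segment (exec-cons {segs = segs} _ e) =
    subst (λ seg → FinalOfT H (proj₁ seg) (proj₂ seg)) (sym (last-∷⁺ _ segs))
      (final-last-segment e)

  inSeq-last-segment : ∀ {s₀ ins segs} → Exec H s₀ ins segs →
                       InSeq H s₀ (toList ins) (proj₁ (last segs))
  inSeq-last-segment (exec-one (_ , first , _)) = inseq-seg first z≤n
  inSeq-last-segment {s₀} {ins} (exec-cons {segs = segs} (_ , first , reaches) e) =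
    subst (InSeq H s₀ (toList ins) ∘ proj₁) (sym (last-∷⁺ _ segs))
      (inseq-later first (subst (λ sf → InSeq H (s-cI , mem sf) _ _) (sym reaches)
                                 (inSeq-last-segment e)))

  reachable-last-segment : ∀ {s₀ ins segs} → ConcreteInitial H s₀ → Exec H s₀ ins segs →
                           Reachable H (proj₁ (last segs))
  reachable-last-segment ci e = inj₂ (_ , _ , ci , inSeq-last-segment e)

  module _ (Spec : (A × D) × SR → O) (sac : SingleActionCorrect H Spec)
           (sfc : StronglyFunctionallyConsistent H) where

    -- Strong consistency is applied with the batch inp s, using load (inp s) s = s by eta.
    output-meets-spec : ∀ s → Initial H s → Reachable H s → ∀ sf → FinalOfT H s sf →
                        ∀ j → out H sf j ≡ Spec (inp H s j , rel H s)
    output-meets-spec s init reach sf fin j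
      with sac (proj₁ (inp H s j)) (proj₂ (inp H s j)) (rel H s) (s , reach , refl)
    ... | s′ , init′ , reach′ , j′ , inp≡ , rel≡ , sf′ , fin′ , out≡ =
      trans (sfc s s′ init init′ reach reach′ (inp H s) (inp H s′) sf sf′ fin fin′
                 j j′ (sym inp≡) (sym rel≡))
            out≡

    functionally-correct : FunctionallyCorrect H Spec
    functionally-correct s₀ ci ins segs e j
      rewrite sym (inp-last-segment e) =
      output-meets-spec (proj₁ (last segs)) (initial-last-segment e (proj₁ ci))
        (reachable-last-segment ci e) (proj₂ (last segs)) (final-last-segment e) j

lemma4 : (Acc : HA) (Spec : (HA.A Acc × HA.D Acc) × HA.SR Acc → HA.O Acc) →
         SingleActionCorrect Acc Spec → ¬ FunctionallyCorrect Acc Spec →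
         ¬ StronglyFunctionallyConsistent Acc
lemma4 Acc Spec sac ¬fc sfc = ¬fc (functionally-correct Acc Spec sac sfc)
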